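{- Let $C, Q$, and $b$ be positive integers and $y, a$ integers. Assuming $b|QC$, $(y, QC/b)=1$ and $(a,C)=1$, we have $$\sum_{D|QC}\;\sum^{*}_{x\,(\bmod \tfrac{QC}{D})}e\left(\frac{Dxa}{C}+ \frac{byx}{\tfrac{QC}{D}}\right) = \begin{cases} QC, \quad &\text{ if }b=Q \text{ and } y\equiv -a \;(\bmod C ),\\ 0, \quad &\text{ otherwise,}\end{cases}$$ where $\sum^{*}$ denotes the sum over residue classes $x$ coprime to the modulus $QC/D$, and $e(x)=\exp(2\pi i x)$. -}

module Defs where

open import Level using (Level)
open import Algebra.Bundles using (CommutativeRing)
open import Data.Nat as ℕ using (ℕ; zero; suc; _≟_)
open import Data.Nat.Divisibility using (_∣?_)
open import Data.Product using (_×_)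
open import Data.Nat.GCD using (gcd)
open import Data.Nat.DivMod using () renaming (_/_ to _/ℕ_)
open import Data.Integer as ℤ using (ℤ; +_; _%ℕ_)
open import Data.List using (List; []; _∷_; filter; upTo; map)
open import Data.Sum using (_⊎_)
open import Data.Empty using (⊥)
open import Relation.Nullary using (¬_)
open import Relation.Binary.PropositionalEquality using (_≡_)

module _ {c ℓ : Level} (R : CommutativeRing c ℓ) where
  open CommutativeRing R

  pow : Carrier → ℕ → Carrier
  pow w zero    = 1#
  pow w (suc n) = w * pow w n

  natCast : ℕ → Carrier
  natCast zero    = 0#
  natCast (suc n) = 1# + natCast n

  sumL : List ℕ → (ℕ → Carrier) → Carrier
  sumL []       f = 0#
  sumL (x ∷ xs) f = f x + sumL xs f

  IsChar0Domain : Set (c Level.⊔ ℓ)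
  IsChar0Domain =
    (∀ x y → x * y ≈ 0# → x ≈ 0# ⊎ y ≈ 0#) × (∀ n → natCast n ≈ 0# → n ≡ 0)

  IsPrimitiveRoot : Carrier → ℕ → Set ℓ
  IsPrimitiveRoot w N =
    (pow w N ≈ 1#) × (∀ d → 0 ℕ.< d → d ℕ.< N → ¬ (pow w d ≈ 1#))

  -- Fix N and a primitive N-th root ω, standing for e(1/N).
  -- eN w N k  =  ω^(k mod N)  =  e(k/N)   (k ∈ ℤ).
  eN : Carrier → ℕ → ℤ → Carrier
  eN w zero    k = 1#   -- unused (N > 0 in the statement)
  eN w (suc n) k = pow w (k %ℕ suc n)

  -- e(num / den) for a denominator den dividing N:  ω^(num · N/den).
  eFrac : Carrier → ℕ → ℤ → ℕ → Carrier
  eFrac w N num zero      = 1#   -- unused (denominators are positive)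
  eFrac w N num (suc den) = eN w N (num ℤ.* + (N /ℕ suc den))

  divisors : ℕ → List ℕ
  divisors n = filter (λ D → D ∣? n) (map suc (upTo n))

  -- Reduced residues x mod m, represented by 0 ≤ x < m with gcd(x,m)=1
  -- (for m = 1 this is the single class x = 0).
  reducedResidues : ℕ → List ℕ
  reducedResidues m = filter (λ x → gcd x m ≟ 1) (upTo m)

  -- The double sum of Lemma 3.2, with ω standing for e(1/(QC)):
  --   Σ_{D | QC} Σ*_{x mod QC/D} e(Dxa/C) e(byx/(QC/D))
  --   = Σ_{D | QC} Σ*_{x mod QC/D} e(Dxa/C + byx/(QC/D))
  lemmaSum : Carrier → (C Q b : ℕ) → (y a : ℤ) → Carrier
  lemmaSum w C Q b y a =
    sumL (divisors N) λ D →
      sumL (reducedResidues (N /ℕ' D)) λ x →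
        eFrac w N (+ D ℤ.* + x ℤ.* a) C
          * eFrac w N (+ b ℤ.* y ℤ.* + x) (N /ℕ' D)
    where
      N = Q ℕ.* C
      _/ℕ'_ : ℕ → ℕ → ℕ
      n /ℕ' zero    = 0
      n /ℕ' suc d   = n /ℕ suc d

module Submission where

-- Put n = aQ + by.  Since N/C = Q and N/(N/D) = D, the (D,x)-term
-- is e(Dx·n/N).  Writing k = Dx, the pairs (D, x) with D ∣ N and x a reduced
-- residue mod N/D are in bijection with the k < N (D = gcd(k,N)), so the
-- double sum is the complete character sum Σ_{k<N} e(kn/N).  That sum is N
-- if N ∣ n and, being a geometric sum of a root of unity ≠ 1, zero otherwise.
-- Finally, under the coprimality hypotheses, N ∣ aQ + by holds iff b = Q and
-- C ∣ y + a.

open import Defs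
open import Level using (Level)
open import Algebra.Bundles using (CommutativeRing)
open import Data.Nat as ℕ using (ℕ; NonZero; zero; suc; _<_; z≤n; s≤s; _≟_)
open import Data.Nat.Divisibility using (_∣?_; divides) renaming (_∣_ to _∣ℕ_)
open import Data.Nat.GCD using (gcd)
open import Data.Nat.DivMod using () renaming (_/_ to _/ℕ_)
open import Data.Integer as ℤ using (ℤ; +_; ∣_∣)
open import Data.Integer.Divisibility using () renaming (_∣_ to _∣ℤ_)
open import Data.Integer.Divisibility.Signed using () renaming (_∣_ to _∣ˢ_)
open import Data.List using ([]; _∷_; filter; upTo; map; applyUpTo)
open import Data.Product using (_×_; _,_)
open import Data.Sum using (_⊎_; inj₁; inj₂)
open import Function using (_∘_)
open import Relation.Nullary using (¬_; Dec; yes; no)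
open import Relation.Nullary.Negation using (contradiction)
open import Relation.Binary.PropositionalEquality as P using (_≡_)
import Data.Nat.Properties as NP
import Data.Nat.Divisibility as ND
import Data.Nat.DivMod as NDM
import Data.Nat.GCD as NG
import Data.Integer.Properties as ZP
import Data.Integer.DivMod as ZD
import Data.Integer.Divisibility as ZU
import Data.Integer.Divisibility.Signed as ZS
import Data.Integer.Tactic.RingSolver as ZR
import Data.Nat.Tactic.RingSolver as NR

-- Finite sums  ∑[ i < n ] h i = h 0 + ⋯ + h (n - 1)  in a commutative ring.
-- Indices are naturals (not Fin n) because the reindexings below compute
-- with them: k = d + j, k = D·x.
module RangeSums {c ℓ : Level} (R : CommutativeRing c ℓ) where
  open CommutativeRing R
  open import Relation.Binary.Reasoning.Setoid setoid
  open import Algebra.Properties.CommutativeSemigroup +-commutativeSemigroup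
    using (interchange)

  sumTo : ℕ → (ℕ → Carrier) → Carrier
  sumTo zero    h = 0#
  sumTo (suc n) h = h 0 + sumTo n (λ i → h (suc i))

  syntax sumTo n (λ i → e) = ∑[ i < n ] e

  when : ∀ {p} {P : Set p} → Dec P → Carrier → Carrier
  when (yes _) v = v
  when (no _)  _ = 0#

  when-yes : ∀ {p} {P : Set p} (P? : Dec P) v → P → when P? v ≈ v
  when-yes (yes _) v _  = refl
  when-yes (no ¬p) v p  = contradiction p ¬p

  when-no : ∀ {p} {P : Set p} (P? : Dec P) v → ¬ P → when P? v ≈ 0#
  when-no (yes p) v ¬p = contradiction p ¬p
  when-no (no _)  v _  = refl

  when-cong : ∀ {p q} {P : Set p} {Q : Set q} (P? : Dec P) (Q? : Dec Q) v →
              (P → Q) → (Q → P) → when P? v ≈ when Q? v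
  when-cong (yes _) (yes _) v _   _   = refl
  when-cong (yes p) (no ¬q) v P⇒Q _   = contradiction (P⇒Q p) ¬q
  when-cong (no ¬p) (yes q) v _   Q⇒P = contradiction (Q⇒P q) ¬p
  when-cong (no _)  (no _)  v _   _   = refl

  when-congʳ : ∀ {p} {P : Set p} (P? : Dec P) {v w} → (P → v ≈ w) → when P? v ≈ when P? w
  when-congʳ (yes p) v≈w = v≈w p
  when-congʳ (no _)  _   = refl

  sumTo-cong : ∀ n {f g : ℕ → Carrier} → (∀ i → f i ≈ g i) → sumTo n f ≈ sumTo n g
  sumTo-cong zero    _   = refl
  sumTo-cong (suc n) f≈g = +-cong (f≈g 0) (sumTo-cong n (λ i → f≈g (suc i)))

  sumTo-zero : ∀ n {f : ℕ → Carrier} → (∀ i → i < n → f i ≈ 0#) → sumTo n f ≈ 0#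
  sumTo-zero zero    _   = refl
  sumTo-zero (suc n) f≈0 = trans
    (+-cong (f≈0 0 (s≤s z≤n)) (sumTo-zero n (λ i i<n → f≈0 (suc i) (s≤s i<n))))
    (+-identityʳ 0#)

  sumTo-+ : ∀ n (f g : ℕ → Carrier) → ∑[ i < n ] (f i + g i) ≈ sumTo n f + sumTo n g
  sumTo-+ zero    f g = sym (+-identityʳ 0#)
  sumTo-+ (suc n) f g = begin
    (f 0 + g 0) + ∑[ i < n ] (f (suc i) + g (suc i))
      ≈⟨ +-cong refl (sumTo-+ n (λ i → f (suc i)) (λ i → g (suc i))) ⟩
    (f 0 + g 0) + (∑[ i < n ] f (suc i) + ∑[ i < n ] g (suc i))
      ≈⟨ interchange _ _ _ _ ⟩
    (f 0 + ∑[ i < n ] f (suc i)) + (g 0 + ∑[ i < n ] g (suc i)) ∎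

  sumTo-*ˡ : ∀ n z (f : ℕ → Carrier) → ∑[ i < n ] (z * f i) ≈ z * sumTo n f
  sumTo-*ˡ zero    z f = sym (zeroʳ z)
  sumTo-*ˡ (suc n) z f =
    trans (+-cong refl (sumTo-*ˡ n z (λ i → f (suc i)))) (sym (distribˡ z _ _))

  sumTo-swap : ∀ m n (f : ℕ → ℕ → Carrier) →
               ∑[ i < m ] ∑[ j < n ] f i j ≈ ∑[ j < n ] ∑[ i < m ] f i j
  sumTo-swap zero    n f = sym (sumTo-zero n (λ _ _ → refl))
  sumTo-swap (suc m) n f = begin
    ∑[ j < n ] f 0 j + ∑[ i < m ] ∑[ j < n ] f (suc i) j
      ≈⟨ +-cong refl (sumTo-swap m n (λ i → f (suc i))) ⟩
    ∑[ j < n ] f 0 j + ∑[ j < n ] ∑[ i < m ] f (suc i) j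
      ≈⟨ sym (sumTo-+ n (f 0) (λ j → ∑[ i < m ] f (suc i) j)) ⟩
    ∑[ j < n ] (f 0 j + ∑[ i < m ] f (suc i) j) ∎

  sumTo-split : ∀ m n (h : ℕ → Carrier) →
                sumTo (m ℕ.+ n) h ≈ sumTo m h + ∑[ j < n ] h (m ℕ.+ j)
  sumTo-split zero    n h = sym (+-identityˡ _)
  sumTo-split (suc m) n h =
    trans (+-cong refl (sumTo-split m n (λ i → h (suc i)))) (sym (+-assoc _ _ _))

  sumTo-last : ∀ n (h : ℕ → Carrier) → sumTo (suc n) h ≈ sumTo n h + h n
  sumTo-last zero    h = trans (+-identityʳ (h 0)) (sym (+-identityˡ (h 0)))
  sumTo-last (suc n) h =
    trans (+-cong refl (sumTo-last n (λ i → h (suc i)))) (sym (+-assoc _ _ _))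

  sumTo-one : ∀ n → ∑[ i < n ] 1# ≈ natCast R n
  sumTo-one zero    = refl
  sumTo-one (suc n) = +-cong refl (sumTo-one n)

  sumTo-unique : ∀ {p} {P : ℕ → Set p} (P? : ∀ i → Dec (P i)) v n j →
                 j < n → P j → (∀ i → P i → i ≡ j) → ∑[ i < n ] when (P? i) v ≈ v
  sumTo-unique P? v (suc n) zero _ P0 unique = trans
    (+-cong (when-yes (P? 0) v P0)
            (sumTo-zero n (λ i _ → when-no (P? (suc i)) v (NP.1+n≢0 ∘ unique (suc i)))))
    (+-identityʳ v)
  sumTo-unique P? v (suc n) (suc j) (s≤s j<n) Pj unique = trans
    (+-cong (when-no (P? 0) v (NP.0≢1+n ∘ unique 0))
            (sumTo-unique (λ i → P? (suc i)) v n j j<n Pj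
                          (λ i → NP.suc-injective ∘ unique (suc i))))
    (+-identityˡ v)

  -- Of 0, 1, …, d - 1 only 0 is a multiple of d.
  sumTo-below-divisor : ∀ d .{{_ : NonZero d}} (h : ℕ → Carrier) →
                        (∀ k → ¬ d ∣ℕ k → h k ≈ 0#) → sumTo d h ≈ h 0
  sumTo-below-divisor (suc d) h off = trans
    (+-cong refl (sumTo-zero d (λ j j<d → off (suc j)
      (λ d∣ → NP.<⇒≱ j<d (NP.≤-pred (ND.∣⇒≤ d∣))))))
    (+-identityʳ (h 0))

  sumTo-multiples : ∀ d .{{_ : NonZero d}} m (h : ℕ → Carrier) →
                    (∀ k → ¬ d ∣ℕ k → h k ≈ 0#) →
                    ∑[ k < d ℕ.* m ] h k ≈ ∑[ x < m ] h (d ℕ.* x)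
  sumTo-multiples d zero    h off = reflexive (P.cong (λ l → sumTo l h) (NP.*-zeroʳ d))
  sumTo-multiples d (suc m) h off = begin
    sumTo (d ℕ.* suc m) h
      ≡⟨ P.cong (λ l → sumTo l h) (NP.*-suc d m) ⟩
    sumTo (d ℕ.+ d ℕ.* m) h
      ≈⟨ sumTo-split d (d ℕ.* m) h ⟩
    sumTo d h + ∑[ k < d ℕ.* m ] h (d ℕ.+ k)
      ≈⟨ +-cong (sumTo-below-divisor d h off) (sumTo-multiples d m (λ k → h (d ℕ.+ k)) off-shifted) ⟩
    h 0 + ∑[ x < m ] h (d ℕ.+ d ℕ.* x)
      ≈⟨ +-cong (reflexive (P.cong h (P.sym (NP.*-zeroʳ d))))
                (sumTo-cong m (λ x → reflexive (P.cong h (P.sym (NP.*-suc d x))))) ⟩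
    ∑[ x < suc m ] h (d ℕ.* x) ∎
    where
    off-shifted : ∀ k → ¬ d ∣ℕ k → h (d ℕ.+ k) ≈ 0#
    off-shifted k d∤k = off (d ℕ.+ k) (λ d∣d+k → d∤k (ND.∣m+n∣m⇒∣n d∣d+k ND.∣-refl))

  sumL-cong : ∀ xs {f g : ℕ → Carrier} → (∀ x → f x ≈ g x) → sumL R xs f ≈ sumL R xs g
  sumL-cong []       _   = refl
  sumL-cong (x ∷ xs) f≈g = +-cong (f≈g x) (sumL-cong xs f≈g)

  sumL-applyUpTo : ∀ n (f : ℕ → ℕ) g → sumL R (applyUpTo f n) g ≈ ∑[ i < n ] g (f i)
  sumL-applyUpTo zero    f g = refl
  sumL-applyUpTo (suc n) f g = +-cong refl (sumL-applyUpTo n (f ∘ suc) g)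

  sumL-map : ∀ xs (f : ℕ → ℕ) g → sumL R (map f xs) g ≈ sumL R xs (g ∘ f)
  sumL-map []       f g = refl
  sumL-map (x ∷ xs) f g = +-cong refl (sumL-map xs f g)

  sumL-filter : ∀ {p} {P : ℕ → Set p} (P? : ∀ x → Dec (P x)) xs g →
                sumL R (filter P? xs) g ≈ sumL R xs (λ x → when (P? x) (g x))
  sumL-filter P? []       g = refl
  sumL-filter P? (x ∷ xs) g with P? x
  ... | yes _ = +-cong refl (sumL-filter P? xs g)
  ... | no _  = trans (sumL-filter P? xs g) (sym (+-identityˡ _))

module Powers {c ℓ : Level} (R : CommutativeRing c ℓ) where
  open CommutativeRing R
  open import Relation.Binary.Reasoning.Setoid setoid
  open import Algebra.Properties.Ring ring using (+-cancelʳ; [y-z]x≈yx-zx)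
  open import Algebra.Properties.Group +-group using (x∙y⁻¹≈ε⇒x≈y; x≈y⇒x∙y⁻¹≈ε)
  open RangeSums R

  pow-+ : ∀ w i j → pow R w (i ℕ.+ j) ≈ pow R w i * pow R w j
  pow-+ w zero    j = sym (*-identityˡ _)
  pow-+ w (suc i) j = trans (*-cong refl (pow-+ w i j)) (sym (*-assoc _ _ _))

  pow-multiple : ∀ w N → pow R w N ≈ 1# → ∀ u → pow R w (u ℕ.* N) ≈ 1#
  pow-multiple w N wᴺ≈1 zero    = refl
  pow-multiple w N wᴺ≈1 (suc u) = begin
    pow R w (N ℕ.+ u ℕ.* N)       ≈⟨ pow-+ w N (u ℕ.* N) ⟩
    pow R w N * pow R w (u ℕ.* N) ≈⟨ *-cong wᴺ≈1 (pow-multiple w N wᴺ≈1 u) ⟩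
    1# * 1#                       ≈⟨ *-identityˡ 1# ⟩
    1# ∎

  -- (z - 1)(1 + z + ⋯ + zⁿ⁻¹) = zⁿ - 1, written without subtraction.
  geometric-telescope : ∀ z n →
    z * ∑[ i < n ] pow R z i + 1# ≈ ∑[ i < n ] pow R z i + pow R z n
  geometric-telescope z n = begin
    z * sumTo n (pow R z) + 1#          ≈⟨ +-comm _ _ ⟩
    1# + z * sumTo n (pow R z)          ≈⟨ +-cong refl (sym (sumTo-*ˡ n z (pow R z))) ⟩
    sumTo (suc n) (pow R z)             ≈⟨ sumTo-last n (pow R z) ⟩
    sumTo n (pow R z) + pow R z n ∎

  geometricSum-vanishes : (∀ x y → x * y ≈ 0# → x ≈ 0# ⊎ y ≈ 0#) →
    ∀ z n → pow R z n ≈ 1# → ¬ z ≈ 1# → ∑[ i < n ] pow R z i ≈ 0#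
  geometricSum-vanishes noZeroDivisors z n zⁿ≈1 z≉1
    with noZeroDivisors (z - 1#) (sumTo n (pow R z)) factorisation
    where
    S : Carrier
    S = sumTo n (pow R z)
    zS≈S : z * S ≈ S
    zS≈S = +-cancelʳ 1# (z * S) S (trans (geometric-telescope z n) (+-cong refl zⁿ≈1))
    factorisation : (z - 1#) * S ≈ 0#
    factorisation = begin
      (z - 1#) * S     ≈⟨ [y-z]x≈yx-zx S z 1# ⟩
      z * S - 1# * S   ≈⟨ +-cong refl (-‿cong (*-identityˡ S)) ⟩
      z * S - S        ≈⟨ x≈y⇒x∙y⁻¹≈ε zS≈S ⟩
      0# ∎
  ... | inj₁ z-1≈0 = contradiction (x∙y⁻¹≈ε⇒x≈y z 1# z-1≈0) z≉1
  ... | inj₂ S≈0   = S≈0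

-- Inside a ring with an N-th root of unity ω, the function e k = ω^(k mod N)
-- plays the role of e(k/N); its complete sums detect divisibility by N.
module Character {c ℓ : Level} (R : CommutativeRing c ℓ) (ω : CommutativeRing.Carrier R)
                 (N : ℕ) .{{_ : NonZero N}}
                 (ωᴺ≈1 : CommutativeRing._≈_ R (pow R ω N) (CommutativeRing.1# R)) where
  open CommutativeRing R
  open import Relation.Binary.Reasoning.Setoid setoid
  open RangeSums R
  open Powers R

  e : ℤ → Carrier
  e k = pow R ω (k ℤ.%ℕ N)

  cancel-multiple : ∀ r t M → r ≡ (r ℤ.+ t ℤ.* M) ℤ.+ (ℤ.- t) ℤ.* M
  cancel-multiple = ZR.solve-∀

  pow-periodic : ∀ {r r′} t → + r′ ≡ + r ℤ.+ t ℤ.* + N → pow R ω r ≈ pow R ω r′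
  pow-periodic {r} {r′} (+ u) r′≡r+uN = begin
    pow R ω r                     ≈⟨ sym (*-identityʳ _) ⟩
    pow R ω r * 1#                ≈⟨ *-cong refl (sym (pow-multiple ω N ωᴺ≈1 u)) ⟩
    pow R ω r * pow R ω (u ℕ.* N) ≈⟨ sym (pow-+ ω r (u ℕ.* N)) ⟩
    pow R ω (r ℕ.+ u ℕ.* N)       ≡⟨ P.cong (pow R ω) (ZP.+-injective r′≡r+uNᴺ) ⟨
    pow R ω r′ ∎
    where
    r′≡r+uNᴺ : + r′ ≡ + (r ℕ.+ u ℕ.* N)
    r′≡r+uNᴺ = P.trans r′≡r+uN (P.trans (P.cong (λ z → + r ℤ.+ z) (P.sym (ZP.pos-* u N)))
                                        (P.sym (ZP.pos-+ r (u ℕ.* N))))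
  pow-periodic {r} {r′} ℤ.-[1+ u ] r′≡r-uN =
    sym (pow-periodic (+ suc u) (P.trans (cancel-multiple (+ r) ℤ.-[1+ u ] (+ N))
                                         (P.cong (λ z → z ℤ.+ + suc u ℤ.* + N) (P.sym r′≡r-uN))))

  e-repr : ∀ {k r} t → k ≡ + r ℤ.+ t ℤ.* + N → e k ≈ pow R ω r
  e-repr {k} {r} t k≡r+tN = pow-periodic (k ℤ./ℕ N ℤ.- t) (P.trans (cancel-multiple (+ r) t (+ N))
    (P.trans (P.cong (λ z → z ℤ.+ (ℤ.- t) ℤ.* + N) (P.trans (P.sym k≡r+tN) (ZD.a≡a%ℕn+[a/ℕn]*n k N)))
             (regroup (+ (k ℤ.%ℕ N)) (k ℤ./ℕ N) t (+ N))))
    where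
    regroup : ∀ x q t M → (x ℤ.+ q ℤ.* M) ℤ.+ (ℤ.- t) ℤ.* M ≡ x ℤ.+ (q ℤ.- t) ℤ.* M
    regroup = ZR.solve-∀

  e-+ : ∀ i j → e (i ℤ.+ j) ≈ e i * e j
  e-+ i j = trans (e-repr (i ℤ./ℕ N ℤ.+ j ℤ./ℕ N) i+j≡) (pow-+ ω (i ℤ.%ℕ N) (j ℤ.%ℕ N))
    where
    regroup : ∀ x q x′ q′ M → (x ℤ.+ q ℤ.* M) ℤ.+ (x′ ℤ.+ q′ ℤ.* M) ≡ (x ℤ.+ x′) ℤ.+ (q ℤ.+ q′) ℤ.* M
    regroup = ZR.solve-∀
    i+j≡ : i ℤ.+ j ≡ + (i ℤ.%ℕ N ℕ.+ j ℤ.%ℕ N) ℤ.+ (i ℤ./ℕ N ℤ.+ j ℤ./ℕ N) ℤ.* + N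
    i+j≡ = P.trans (P.cong₂ ℤ._+_ (ZD.a≡a%ℕn+[a/ℕn]*n i N) (ZD.a≡a%ℕn+[a/ℕn]*n j N))
           (P.trans (regroup (+ (i ℤ.%ℕ N)) (i ℤ./ℕ N) (+ (j ℤ.%ℕ N)) (j ℤ./ℕ N) (+ N))
                    (P.cong (λ z → z ℤ.+ (i ℤ./ℕ N ℤ.+ j ℤ./ℕ N) ℤ.* + N)
                            (P.sym (ZP.pos-+ (i ℤ.%ℕ N) (j ℤ.%ℕ N)))))

  e-multiple : ∀ {k} → + N ∣ˢ k → e k ≈ 1#
  e-multiple (ZS.divides t k≡tN) = e-repr t (P.trans k≡tN (P.sym (ZP.+-identityˡ _)))

  e-scale : ∀ k j → e (+ j ℤ.* k) ≈ pow R (e k) j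
  e-scale k zero    = e-multiple (ZS.divides (+ 0)
                        (P.trans (ZP.*-zeroˡ k) (P.sym (ZP.*-zeroˡ (+ N)))))
  e-scale k (suc j) = begin
    e (+ suc j ℤ.* k)      ≡⟨ P.cong e (unfold (+ j) k) ⟩
    e (k ℤ.+ + j ℤ.* k)    ≈⟨ e-+ k (+ j ℤ.* k) ⟩
    e k * e (+ j ℤ.* k)    ≈⟨ *-cong refl (e-scale k j) ⟩
    e k * pow R (e k) j ∎
    where
    unfold : ∀ j k → (+ 1 ℤ.+ j) ℤ.* k ≡ k ℤ.+ j ℤ.* k
    unfold = ZR.solve-∀

  e-nontrivial : (∀ d → 0 < d → d < N → ¬ pow R ω d ≈ 1#) →
                 ∀ k → ¬ + N ∣ˢ k → ¬ e k ≈ 1#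
  e-nontrivial isPrimitive k N∤k with k ℤ.%ℕ N in k%N≡
  ... | zero  = λ _ → N∤k (ZS.divides (k ℤ./ℕ N)
                  (P.trans (ZD.a≡a%ℕn+[a/ℕn]*n k N)
                  (P.trans (P.cong (λ z → + z ℤ.+ (k ℤ./ℕ N) ℤ.* + N) k%N≡)
                           (ZP.+-identityˡ _))))
  ... | suc r = isPrimitive (suc r) (s≤s z≤n) (P.subst (_< N) k%N≡ (ZD.n%ℕd<d k N))

  characterSum : ℤ → Carrier
  characterSum k = ∑[ j < N ] e (+ j ℤ.* k)

  characterSum-multiple : ∀ k → + N ∣ˢ k → characterSum k ≈ natCast R N
  characterSum-multiple k N∣k =
    trans (sumTo-cong N (λ j → e-multiple (ZS.∣n⇒∣m*n (+ j) N∣k))) (sumTo-one N)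

  -- If N ∤ k the sum is geometric in the root of unity e k ≠ 1, hence 0.
  characterSum-nonmultiple : (∀ x y → x * y ≈ 0# → x ≈ 0# ⊎ y ≈ 0#) →
    (∀ d → 0 < d → d < N → ¬ pow R ω d ≈ 1#) →
    ∀ k → ¬ + N ∣ˢ k → characterSum k ≈ 0#
  characterSum-nonmultiple noZeroDivisors isPrimitive k N∤k =
    trans (sumTo-cong N (e-scale k))
          (geometricSum-vanishes noZeroDivisors (e k) N eᴺ≈1 (e-nontrivial isPrimitive k N∤k))
    where
    eᴺ≈1 : pow R (e k) N ≈ 1#
    eᴺ≈1 = trans (sym (e-scale k N)) (e-multiple (ZS.∣m⇒∣m*n k (ZS.∣-refl {+ N})))

-- Each k < N is uniquely k = D·x with D ∣ N and x a reduced residue modulo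
-- N/D (namely D = gcd(k,N)), so a sum over k < N regroups as a divisor sum of
-- reduced-residue sums.
module DivisorSums {c ℓ : Level} (R : CommutativeRing c ℓ) (N : ℕ) .{{_ : NonZero N}} where
  open CommutativeRing R
  open import Relation.Binary.Reasoning.Setoid setoid
  open RangeSums R

  -- The divisor list of Defs as a bracketed range sum over D = i + 1 ≤ N.
  sumL-divisors : ∀ (F : ℕ → Carrier) →
                  sumL R (divisors R N) F ≈ ∑[ i < N ] when (suc i ∣? N) (F (suc i))
  sumL-divisors F = trans (sumL-filter (_∣? N) (map suc (upTo N)) F)
                   (trans (sumL-map (upTo N) suc _) (sumL-applyUpTo N (λ i → i) _))

  sumTo-gcdIndex : ∀ k v → ∑[ i < N ] when (gcd k N ≟ suc i) v ≈ v
  sumTo-gcdIndex k v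
    with gcd k N | NG.gcd[m,n]≢0 k N (inj₂ (ℕ.≢-nonZero⁻¹ N)) | NG.gcd[m,n]≤n k N
  ... | zero  | g≢0 | _   = contradiction P.refl g≢0
  ... | suc j | _   | g≤N = sumTo-unique (λ i → suc j ≟ suc i) v N j g≤N P.refl
                              (λ i j≡i → P.sym (NP.suc-injective j≡i))

  reducedResidueSum≈gcdClassSum : ∀ i (f : ℕ → Carrier) → suc i ∣ℕ N →
    sumL R (reducedResidues R (N /ℕ suc i)) (λ x → f (suc i ℕ.* x))
      ≈ ∑[ k < N ] when (gcd k N ≟ suc i) (f k)
  reducedResidueSum≈gcdClassSum i f D∣N = begin
    sumL R (reducedResidues R m) (λ x → f (D ℕ.* x))
      ≈⟨ sumL-filter (λ x → gcd x m ≟ 1) (upTo m) _ ⟩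
    sumL R (upTo m) (λ x → when (gcd x m ≟ 1) (f (D ℕ.* x)))
      ≈⟨ sumL-applyUpTo m (λ x → x) _ ⟩
    ∑[ x < m ] when (gcd x m ≟ 1) (f (D ℕ.* x))
      ≈⟨ sumTo-cong m (λ x → when-cong (gcd x m ≟ 1) (gcd (D ℕ.* x) N ≟ D) _
                               (coprime⇒gcd≡D x) (gcd≡D⇒coprime x)) ⟩
    ∑[ x < m ] when (gcd (D ℕ.* x) N ≟ D) (f (D ℕ.* x))
      ≈⟨ sumTo-multiples D m (λ k → when (gcd k N ≟ D) (f k)) vanishes-off-multiples ⟨
    ∑[ k < D ℕ.* m ] when (gcd k N ≟ D) (f k)
      ≡⟨ P.cong (λ l → ∑[ k < l ] when (gcd k N ≟ D) (f k)) (NDM.m*[n/m]≡n D∣N) ⟩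
    ∑[ k < N ] when (gcd k N ≟ D) (f k) ∎
    where
    D m : ℕ
    D = suc i
    m = N /ℕ D
    gcd-Dx : ∀ x → gcd (D ℕ.* x) N ≡ D ℕ.* gcd x m
    gcd-Dx x = P.trans (P.cong (gcd (D ℕ.* x)) (P.sym (NDM.m*[n/m]≡n D∣N)))
                       (P.sym (NG.c*gcd[m,n]≡gcd[cm,cn] D x m))
    coprime⇒gcd≡D : ∀ x → gcd x m ≡ 1 → gcd (D ℕ.* x) N ≡ D
    coprime⇒gcd≡D x g≡1 = P.trans (gcd-Dx x) (P.trans (P.cong (D ℕ.*_) g≡1) (NP.*-identityʳ D))
    gcd≡D⇒coprime : ∀ x → gcd (D ℕ.* x) N ≡ D → gcd x m ≡ 1
    gcd≡D⇒coprime x g≡D = NP.*-cancelˡ-≡ (gcd x m) 1 D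
      (P.trans (P.sym (gcd-Dx x)) (P.trans g≡D (P.sym (NP.*-identityʳ D))))
    vanishes-off-multiples : ∀ k → ¬ D ∣ℕ k → when (gcd k N ≟ D) (f k) ≈ 0#
    vanishes-off-multiples k D∤k = when-no (gcd k N ≟ D) (f k)
      (λ g≡D → D∤k (P.subst (_∣ℕ k) g≡D (NG.gcd[m,n]∣m k N)))

  divisorTerm≈gcdClassSum : ∀ (f : ℕ → Carrier) i →
    when (suc i ∣? N) (sumL R (reducedResidues R (N /ℕ suc i)) (λ x → f (suc i ℕ.* x)))
      ≈ ∑[ k < N ] when (gcd k N ≟ suc i) (f k)
  divisorTerm≈gcdClassSum f i with suc i ∣? N
  ... | yes D∣N = reducedResidueSum≈gcdClassSum i f D∣N
  ... | no  D∤N = sym (sumTo-zero N (λ k _ → when-no (gcd k N ≟ suc i) (f k)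
                    (λ g≡D → D∤N (P.subst (_∣ℕ N) g≡D (NG.gcd[m,n]∣n k N)))))

  divisorSum-reindex : ∀ (f : ℕ → Carrier) →
    ∑[ i < N ] when (suc i ∣? N)
                 (sumL R (reducedResidues R (N /ℕ suc i)) (λ x → f (suc i ℕ.* x)))
      ≈ ∑[ k < N ] f k
  divisorSum-reindex f = begin
    ∑[ i < N ] when (suc i ∣? N)
                 (sumL R (reducedResidues R (N /ℕ suc i)) (λ x → f (suc i ℕ.* x)))
      ≈⟨ sumTo-cong N (divisorTerm≈gcdClassSum f) ⟩
    ∑[ i < N ] ∑[ k < N ] when (gcd k N ≟ suc i) (f k)
      ≈⟨ sumTo-swap N N (λ i k → when (gcd k N ≟ suc i) (f k)) ⟩
    ∑[ k < N ] ∑[ i < N ] when (gcd k N ≟ suc i) (f k)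
      ≈⟨ sumTo-cong N (λ k → sumTo-gcdIndex k (f k)) ⟩
    ∑[ k < N ] f k ∎

-- The numerator n = aQ + by: the (D, x)-term of the lemma is e(D·x·n / QC).
numerator : (Q b : ℕ) (y a : ℤ) → ℤ
numerator Q b y a = a ℤ.* + Q ℤ.+ + b ℤ.* y

module Divisibility (Q C b : ℕ) .{{_ : NonZero Q}} .{{_ : NonZero b}}
                    (y a : ℤ) where

  N : ℕ
  N = Q ℕ.* C

  n : ℤ
  n = numerator Q b y a

  n≡Q[y+a] : b ≡ Q → n ≡ + Q ℤ.* (y ℤ.- ℤ.- a)
  n≡Q[y+a] P.refl = factor a (+ Q) y
    where
    factor : ∀ a Q y → a ℤ.* Q ℤ.+ Q ℤ.* y ≡ Q ℤ.* (y ℤ.- ℤ.- a)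
    factor = ZR.solve-∀

  -- Q ∣ b: both b·y and b·(N/b) = N are multiples of Q, and (y, N/b) = 1.
  Q∣b : b ∣ℕ N → gcd ∣ y ∣ (N /ℕ b) ≡ 1 → + N ∣ˢ n → Q ∣ℕ b
  Q∣b b∣N y⊥t N∣n = P.subst (Q ∣ℕ_) gcd≡b (NG.gcd-greatest Q∣b∣y∣ Q∣bt)
    where
    t : ℕ
    t = N /ℕ b
    Q∣N : + Q ∣ˢ + N
    Q∣N = ZS.divides (+ C) (P.trans (ZP.pos-* Q C) (ZP.*-comm (+ Q) (+ C)))
    Q∣by : + Q ∣ˢ + b ℤ.* y
    Q∣by = ZS.∣m+n∣m⇒∣n (ZS.∣-trans Q∣N N∣n) (ZS.∣n⇒∣m*n a (ZS.∣-refl {+ Q}))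
    Q∣b∣y∣ : Q ∣ℕ b ℕ.* ∣ y ∣
    Q∣b∣y∣ = P.subst (Q ∣ℕ_) (ZP.abs-* (+ b) y) (ZS.∣⇒∣ᵤ Q∣by)
    Q∣bt : Q ∣ℕ b ℕ.* t
    Q∣bt = P.subst (Q ∣ℕ_) (P.sym (P.trans (NP.*-comm b t) (NDM.m/n*n≡m b∣N))) (ND.m∣m*n C)
    gcd≡b : gcd (b ℕ.* ∣ y ∣) (b ℕ.* t) ≡ b
    gcd≡b = P.trans (P.sym (NG.c*gcd[m,n]≡gcd[cm,cn] b ∣ y ∣ t))
                    (P.trans (P.cong (b ℕ.*_) y⊥t) (NP.*-identityʳ b))

  -- b = Q: writing b = sQ, s divides a (as b ∣ aQ) and C (as C = (N/b)·s),
  -- and (a, C) = 1.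
  Q∣b⇒b≡Q : b ∣ℕ N → gcd ∣ a ∣ C ≡ 1 → + N ∣ˢ n → Q ∣ℕ b → b ≡ Q
  Q∣b⇒b≡Q b∣N a⊥C N∣n (divides s b≡sQ) =
    P.trans b≡sQ (P.trans (P.cong (ℕ._* Q) s≡1) (NP.*-identityˡ Q))
    where
    t : ℕ
    t = N /ℕ b
    tb≡N : t ℕ.* b ≡ N
    tb≡N = NDM.m/n*n≡m b∣N
    b∣aQ : + b ∣ˢ a ℤ.* + Q
    b∣aQ = ZS.∣m+n∣n⇒∣m (ZS.∣-trans (ZS.divides (+ t) (P.trans (P.cong +_ (P.sym tb≡N)) (ZP.pos-* t b))) N∣n)
                        (ZS.∣m⇒∣m*n y (ZS.∣-refl {+ b}))
    s∣a : + s ∣ˢ a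
    s∣a = ZS.*-cancelʳ-∣ (+ Q)
            (P.subst (ZS._∣ a ℤ.* + Q) (P.trans (P.cong +_ b≡sQ) (ZP.pos-* s Q)) b∣aQ)
    rearrange : ∀ t s Q → t ℕ.* (s ℕ.* Q) ≡ Q ℕ.* (t ℕ.* s)
    rearrange = NR.solve-∀
    s∣C : s ∣ℕ C
    s∣C = divides t (NP.*-cancelˡ-≡ C (t ℕ.* s) Q
            (P.trans (P.sym tb≡N) (P.trans (P.cong (t ℕ.*_) b≡sQ) (rearrange t s Q))))
    s≡1 : s ≡ 1
    s≡1 = ND.∣1⇒≡1 (P.subst (s ∣ℕ_) a⊥C (NG.gcd-greatest (ZS.∣⇒∣ᵤ s∣a) s∣C))

  C∣y+a : b ≡ Q → + N ∣ˢ n → + C ∣ℤ (y ℤ.- ℤ.- a)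
  C∣y+a b≡Q N∣n = ZU.*-cancelˡ-∣ (+ Q)
    (P.subst₂ _∣ℤ_ (ZP.pos-* Q C) (n≡Q[y+a] b≡Q) (ZS.∣⇒∣ᵤ N∣n))

  criterion-forward : b ∣ℕ N → gcd ∣ y ∣ (N /ℕ b) ≡ 1 → gcd ∣ a ∣ C ≡ 1 →
                      + N ∣ˢ n → b ≡ Q × + C ∣ℤ (y ℤ.- ℤ.- a)
  criterion-forward b∣N y⊥t a⊥C N∣n = b≡Q , C∣y+a b≡Q N∣n
    where
    b≡Q : b ≡ Q
    b≡Q = Q∣b⇒b≡Q b∣N a⊥C N∣n (Q∣b b∣N y⊥t N∣n)

  criterion-backward : b ≡ Q × + C ∣ℤ (y ℤ.- ℤ.- a) → + N ∣ˢ n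
  criterion-backward (b≡Q , C∣y+a) = ZS.∣ᵤ⇒∣
    (P.subst₂ _∣ℤ_ (P.sym (ZP.pos-* Q C)) (P.sym (n≡Q[y+a] b≡Q)) (ZU.*-monoʳ-∣ (+ Q) C∣y+a))

module DoubleSum {c ℓ : Level} (R : CommutativeRing c ℓ) (ω : CommutativeRing.Carrier R)
                 (q c′ b : ℕ) (y a : ℤ)
                 (ωᴺ≈1 : CommutativeRing._≈_ R (pow R ω (suc q ℕ.* suc c′)) (CommutativeRing.1# R))
                 where
  open CommutativeRing R
  open import Relation.Binary.Reasoning.Setoid setoid
  open RangeSums R

  Q C N : ℕ
  Q = suc q
  C = suc c′
  N = Q ℕ.* C

  open Character R ω N ωᴺ≈1
  open DivisorSums R N

  n : ℤ
  n = numerator Q b y a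

  N≡D*[N/D] : ∀ i {m} → suc i ∣ℕ N → N /ℕ suc i ≡ m → N ≡ suc i ℕ.* m
  N≡D*[N/D] i D∣N N/D≡m = P.trans (P.sym (NDM.m*[n/m]≡n D∣N)) (P.cong (suc i ℕ.*_) N/D≡m)

  -- Since N/C = Q and N/(N/D) = D, the (D, x)-term is e(D·x·n/N).
  term≈character : ∀ i x → suc i ∣ℕ N →
    eFrac R ω N (+ suc i ℤ.* + x ℤ.* a) C * eFrac R ω N (+ b ℤ.* y ℤ.* + x) (N /ℕ suc i)
      ≈ e (+ (suc i ℕ.* x) ℤ.* n)
  term≈character i x D∣N with N /ℕ suc i in N/D≡
  ... | zero    = contradiction (P.trans (N≡D*[N/D] i D∣N N/D≡) (NP.*-zeroʳ (suc i))) (λ ())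
  ... | suc m′  = begin
    e (num₁ ℤ.* + (N /ℕ C)) * e (num₂ ℤ.* + (N /ℕ suc m′))
      ≡⟨ P.cong₂ (λ u v → e (num₁ ℤ.* + u) * e (num₂ ℤ.* + v)) (NDM.m*n/n≡m Q C) N/[N/D]≡D ⟩
    e (num₁ ℤ.* + Q) * e (num₂ ℤ.* + D)
      ≈⟨ e-+ (num₁ ℤ.* + Q) (num₂ ℤ.* + D) ⟨
    e (num₁ ℤ.* + Q ℤ.+ num₂ ℤ.* + D)
      ≡⟨ P.cong e (P.trans (collect (+ D) (+ x) a (+ Q) (+ b) y)
                           (P.cong (ℤ._* n) (P.sym (ZP.pos-* D x)))) ⟩
    e (+ (D ℕ.* x) ℤ.* n) ∎
    where
    D : ℕ
    D = suc i
    num₁ num₂ : ℤ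
    num₁ = + D ℤ.* + x ℤ.* a
    num₂ = + b ℤ.* y ℤ.* + x
    N/[N/D]≡D : N /ℕ suc m′ ≡ D
    N/[N/D]≡D = P.trans (P.cong (_/ℕ suc m′) (N≡D*[N/D] i D∣N N/D≡)) (NDM.m*n/n≡m D (suc m′))
    collect : ∀ D x a Q b y →
      (D ℤ.* x ℤ.* a) ℤ.* Q ℤ.+ (b ℤ.* y ℤ.* x) ℤ.* D ≡ (D ℤ.* x) ℤ.* (a ℤ.* Q ℤ.+ b ℤ.* y)
    collect = ZR.solve-∀

  lemmaSum≈characterSum : lemmaSum R ω C Q b y a ≈ characterSum n
  lemmaSum≈characterSum = begin
    lemmaSum R ω C Q b y a
      ≈⟨ sumL-divisors _ ⟩
    ∑[ i < N ] when (suc i ∣? N) (sumL R (reducedResidues R (N /ℕ suc i)) (λ x →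
      eFrac R ω N (+ suc i ℤ.* + x ℤ.* a) C * eFrac R ω N (+ b ℤ.* y ℤ.* + x) (N /ℕ suc i)))
      ≈⟨ sumTo-cong N (λ i → when-congʳ (suc i ∣? N) (λ D∣N →
           sumL-cong (reducedResidues R (N /ℕ suc i)) (λ x → term≈character i x D∣N))) ⟩
    ∑[ i < N ] when (suc i ∣? N)
      (sumL R (reducedResidues R (N /ℕ suc i)) (λ x → e (+ (suc i ℕ.* x) ℤ.* n)))
      ≈⟨ divisorSum-reindex (λ k → e (+ k ℤ.* n)) ⟩
    characterSum n ∎

lemma3p2 : ∀ {c ℓ : Level} (R : CommutativeRing c ℓ) → IsChar0Domain R
         → (C Q b : ℕ) → .{{_ : NonZero C}} → .{{_ : NonZero Q}} → .{{_ : NonZero b}}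
         → (y a : ℤ)
         → (ω : CommutativeRing.Carrier R) → IsPrimitiveRoot R ω (Q ℕ.* C)
         → b ∣ℕ (Q ℕ.* C)
         → gcd ∣ y ∣ ((Q ℕ.* C) /ℕ b) ≡ 1
         → gcd ∣ a ∣ C ≡ 1
         → ((b ≡ Q × (+ C) ∣ℤ (y ℤ.- (ℤ.- a)))
              → CommutativeRing._≈_ R (lemmaSum R ω C Q b y a) (natCast R (Q ℕ.* C)))
           × (¬ (b ≡ Q × (+ C) ∣ℤ (y ℤ.- (ℤ.- a)))
              → CommutativeRing._≈_ R (lemmaSum R ω C Q b y a) (CommutativeRing.0# R))
lemma3p2 R (noZeroDivisors , _) (suc c′) (suc q) b y a ω (ωᴺ≈1 , isPrimitive) b∣N y⊥N/b a⊥C =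
    (λ b≡Q∧C∣y+a → trans lemmaSum≈characterSum
       (characterSum-multiple n (criterion-backward b≡Q∧C∣y+a)))
  , (λ ¬[b≡Q∧C∣y+a] → trans lemmaSum≈characterSum
       (characterSum-nonmultiple noZeroDivisors isPrimitive n
         (¬[b≡Q∧C∣y+a] ∘ criterion-forward b∣N y⊥N/b a⊥C)))
  where
  open CommutativeRing R using (trans)
  open DoubleSum R ω q c′ b y a ωᴺ≈1 using (N; n; lemmaSum≈characterSum)
  open Character R ω N ωᴺ≈1 using (characterSum-multiple; characterSum-nonmultiple)
  open Divisibility (suc q) (suc c′) b y a using (criterion-forward; criterion-backward)
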